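{- For all integers $n\ge1$, $S\ge1$ and $1\le i\le n$, we have $s(i)>n/S^{1/i}$.
   Context: For integers $s\ge0$, $(s)_i=s(s-1)\cdots(s-i+1)$ is the falling factorial, and $s(i)=\min\{s\in\mathbb{Z}_{\ge0}: (s)_i>(n)_i/S\}$. -}

module Defs where

open import Data.Nat using (ℕ; zero; suc; _*_; _∸_; _<_; _≤_)
open import Data.Product using (_×_)

-- falling factorial (s)_i = s (s-1) ... (s-i+1); (s)_0 = 1.
-- For i > s a factor s ∸ s = 0 occurs, so truncated subtraction is harmless.
ff : ℕ → ℕ → ℕ
ff s zero    = 1
ff s (suc i) = ff s i * (s ∸ i)

-- The defining condition of s(i): (s)_i > (n)_i / S, cleared of the
-- denominator (S ≥ 1):  (n)_i < (s)_i * S.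
Cond : ℕ → ℕ → ℕ → ℕ → Set
Cond n S i s = ff n i < ff s i * S

IsSi : ℕ → ℕ → ℕ → ℕ → Set
IsSi n S i s = Cond n S i s × (∀ t → Cond n S i t → s ≤ t)

{-# OPTIONS --safe #-}
-- For s ≤ n every factor satisfies (s − j)/(n − j) ≤ s/n, hence
-- (s)_i/(n)_i ≤ (s/n)^i; together with (n)_i/S < (s)_i this gives n^i/S < s^i.
-- For s > n the bound is immediate. Only the defining inequality of s(i) is
-- used, not its minimality.
module Submission where

open import Defs
open import Data.Nat using (ℕ; zero; suc; _^_; _*_; _∸_; _<_; _≤_; NonZero; >-nonZero)
open import Data.Nat.Properties
open import Algebra.Properties.CommutativeSemigroup *-commutativeSemigroup
  using (xy∙z≈xz∙y)
open import Data.Nat.Solver using (module +-*-Solver)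
open import Data.Product using (_,_)
open import Data.Sum using (inj₁; inj₂)
open import Relation.Binary.PropositionalEquality using (_≡_; refl; sym; subst₂)

m≤n⇒[m∸o]*n≤m*[n∸o] : ∀ {m n} o → m ≤ n → (m ∸ o) * n ≤ m * (n ∸ o)
m≤n⇒[m∸o]*n≤m*[n∸o] {m} {n} o m≤n =
  subst₂ _≤_ (sym (*-distribʳ-∸ n m o)) (sym (*-distribˡ-∸ m n o))
    (∸-monoʳ-≤ (m * n) (subst₂ _≤_ (*-comm o m) refl (*-monoʳ-≤ o m≤n)))

s≤n⇒n^i*ff-s≤s^i*ff-n : ∀ {s n} i → s ≤ n → n ^ i * ff s i ≤ s ^ i * ff n i
s≤n⇒n^i*ff-s≤s^i*ff-n zero    _   = ≤-refl
s≤n⇒n^i*ff-s≤s^i*ff-n {s} {n} (suc i) s≤n = begin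
  n * n ^ i * (ff s i * (s ∸ i))   ≡⟨ [ab][cd]≡[bc][da] n (n ^ i) (ff s i) (s ∸ i) ⟩
  n ^ i * ff s i * ((s ∸ i) * n)   ≤⟨ *-mono-≤ (s≤n⇒n^i*ff-s≤s^i*ff-n i s≤n)
                                               (m≤n⇒[m∸o]*n≤m*[n∸o] i s≤n) ⟩
  s ^ i * ff n i * (s * (n ∸ i))   ≡⟨ sym ([ab][cd]≡[bc][ad] s (s ^ i) (ff n i) (n ∸ i)) ⟩
  s * s ^ i * (ff n i * (n ∸ i))   ∎
  where
  open ≤-Reasoning
  open +-*-Solver
  [ab][cd]≡[bc][da] : ∀ a b c d → a * b * (c * d) ≡ b * c * (d * a)
  [ab][cd]≡[bc][da] = solve 4 (λ a b c d → a :* b :* (c :* d) := b :* c :* (d :* a)) refl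
  [ab][cd]≡[bc][ad] : ∀ a b c d → a * b * (c * d) ≡ b * c * (a * d)
  [ab][cd]≡[bc][ad] = solve 4 (λ a b c d → a :* b :* (c :* d) := b :* c :* (a :* d)) refl

Cond∧s≤n⇒n^i<s^i*S : ∀ {n S s} i .{{_ : NonZero n}} →
  s ≤ n → Cond n S i s → n ^ i < s ^ i * S
Cond∧s≤n⇒n^i<s^i*S {n} {S} {s} i s≤n cond =
  *-cancelʳ-< (ff n i) (n ^ i) (s ^ i * S) (begin-strict
    n ^ i * ff n i         <⟨ *-monoʳ-< (n ^ i) {{m^n≢0 n i}} cond ⟩
    n ^ i * (ff s i * S)   ≡⟨ sym (*-assoc (n ^ i) (ff s i) S) ⟩
    n ^ i * ff s i * S     ≤⟨ *-monoˡ-≤ S (s≤n⇒n^i*ff-s≤s^i*ff-n i s≤n) ⟩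
    s ^ i * ff n i * S     ≡⟨ xy∙z≈xz∙y (s ^ i) (ff n i) S ⟩
    s ^ i * S * ff n i     ∎)
  where open ≤-Reasoning

lemma3p1 : ∀ (n S i s : ℕ) → 1 ≤ n → 1 ≤ S → 1 ≤ i → i ≤ n →
    IsSi n S i s → n ^ i < s ^ i * S
lemma3p1 n S i s 1≤n 1≤S 1≤i _ (cond , _) with ≤-<-connex s n
... | inj₁ s≤n = Cond∧s≤n⇒n^i<s^i*S i {{>-nonZero 1≤n}} s≤n cond
... | inj₂ n<s = <-≤-trans (^-monoˡ-< i {{>-nonZero 1≤i}} n<s)
                            (m≤m*n (s ^ i) S {{>-nonZero 1≤S}})
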